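{- Let $\Sigma$ be any subexponential signature. A sequent is derivable in $\mathrm{SCLL}_\Sigma + (\mathrm{cut})$ if and only if it is derivable in (cut-free) $\mathrm{SCLL}_\Sigma$.
   Context: A subexponential signature is a tuple $\Sigma = \langle \mathcal{I}, \preceq, \mathcal{W}, \mathcal{C}, \mathcal{E}\rangle$ where $\mathcal{I}$ is a finite set of labels, $\preceq$ is a preorder on $\mathcal{I}$, and $\mathcal{W},\mathcal{C},\mathcal{E}\subseteq\mathcal{I}$ are upwardly closed with respect to $\preceq$ (if $s\in\mathcal{W}$ and $s\preceq s'$ then $s'\in\mathcal{W}$; likewise for $\mathcal{C},\mathcal{E}$), and $\mathcal{W}\cap\mathcal{C}\subseteq\mathcal{E}$. Cyclic linear logic with subexponentials, $\mathrm{SCLL}_\Sigma$. Atoms are variables $p_1,p_2,\dots$ and their negations $\bar p_1,\bar p_2,\dots$. Formulae are built from atoms and constants $\mathbf{1},\bot,\top,\mathbf{0}$ using binary connectives $\otimes$ (multiplicative conjunction), $\wp$ (multiplicative disjunction, "par"), $\mathbin{\&}$ (additive conjunction), $\oplus$ (additive disjunction), and unary connectives ${!}^s$, ${?}^s$ for each $s\in\mathcal{I}$. Negation $A^\bot$ is defined recursively: $p_i^\bot=\bar p_i$, $\bar p_i^\bot=p_i$, $(A\otimes B)^\bot=B^\bot\wp A^\bot$, $(A\wp B)^\bot=B^\bot\otimes A^\bot$, $(A\oplus B)^\bot=A^\bot\mathbin{\&}B^\bot$, $(A\mathbin{\&}B)^\bot=A^\bot\oplus B^\bot$, $({!}^sA)^\bot={?}^sA^\bot$,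 $({?}^sA)^\bot={!}^sA^\bot$, $\mathbf{1}^\bot=\bot$, $\bot^\bot=\mathbf{1}$, $\mathbf{0}^\bot=\top$, $\top^\bot=\mathbf{0}$. Sequents have the form $\vdash\Gamma$ where $\Gamma$ is a nonempty cyclically ordered sequence of formulae: $\vdash\Gamma_1,\Gamma_2$ and $\vdash\Gamma_2,\Gamma_1$ are identified, and no other permutations are allowed. The axioms and rules of (cut-free) $\mathrm{SCLL}_\Sigma$ are: (ax) $\vdash A,A^\bot$; ($\otimes$) from $\vdash\Gamma,A$ and $\vdash B,\Delta$ infer $\vdash\Gamma,A\otimes B,\Delta$; ($\wp$) from $\vdash A,B,\Gamma$ infer $\vdash A\wp B,\Gamma$; ($\mathbin{\&}$) from $\vdash A_1,\Gamma$ and $\vdash A_2,\Gamma$ infer $\vdash A_1\mathbin{\&}A_2,\Gamma$; ($\oplus$) from $\vdash A_i,\Gamma$ ($i=1$ or $2$) infer $\vdash A_1\oplus A_2,\Gamma$; ($\mathbf{1}$) $\vdash\mathbf{1}$; ($\bot$) from $\vdash\Gamma$ infer $\vdash\bot,\Gamma$; ($\top$) $\vdash\top,\Gamma$ for any $\Gamma$; (${!}$) from $\vdash B,{?}^{s_1}A_1,\dots,{?}^{s_n}A_n$ infer $\vdash{!}^sB,{?}^{s_1}A_1,\dots,{?}^{s_n}A_n$, provided $s\preceq s_j$ for all $j$; (${?}$) from $\vdash A,\Gamma$ infer $\vdash{?}^sA,\Gamma$; (weak) for $s\in\mathcal{W}$: from $\vdash\Gamma$ infer $\vdash{?}^sA,\Gamma$;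 (ncontr) for $s\in\mathcal{C}$: from $\vdash{?}^sA,\Gamma,{?}^sA,\Delta$ infer $\vdash{?}^sA,\Gamma,\Delta$; (ex) for $s\in\mathcal{E}$: from $\vdash\Gamma,{?}^sA,\Delta$ infer $\vdash{?}^sA,\Gamma,\Delta$. There is no rule for $\mathbf{0}$. The cut rule is: from $\vdash\Gamma,A^\bot$ and $\vdash A,\Delta$ infer $\vdash\Gamma,\Delta$; $\mathrm{SCLL}_\Sigma+(\mathrm{cut})$ denotes the system with this rule added. -}

module Defs where

open import Level using (0ℓ)
open import Data.Nat using (ℕ)
open import Data.Fin using (Fin)
open import Data.Bool using (Bool; true; false; T)
open import Data.Product using (_×_; _,_; proj₁; proj₂)
open import Data.List using (List; []; _∷_; _++_; [_]; map)
open import Data.List.Relation.Unary.All using (All)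
open import Relation.Binary.PropositionalEquality using (_≢_)

record Signature : Set₁ where
  field
    n      : ℕ
    _≼_    : Fin n → Fin n → Set
    ≼-refl  : ∀ {s} → s ≼ s
    ≼-trans : ∀ {s t u} → s ≼ t → t ≼ u → s ≼ u
    W C E  : Fin n → Set
    W-up   : ∀ {s s'} → W s → s ≼ s' → W s'
    C-up   : ∀ {s s'} → C s → s ≼ s' → C s'
    E-up   : ∀ {s s'} → E s → s ≼ s' → E s'
    WC⊆E   : ∀ {s} → W s → C s → E s

data Fm (k : ℕ) : Set where
  var nvar : ℕ → Fm k
  𝟏 ⊥' ⊤' 𝟎 : Fm k
  _⊗_ _⅋_ _&_ _⊕_ : Fm k → Fm k → Fm k
  !_·_ ¿_·_ : Fin k → Fm k → Fm k

_ᗮ : ∀ {k} → Fm k → Fm k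
var i ᗮ = nvar i
nvar i ᗮ = var i
𝟏 ᗮ = ⊥'
⊥' ᗮ = 𝟏
⊤' ᗮ = 𝟎
𝟎 ᗮ = ⊤'
(A ⊗ B) ᗮ = (B ᗮ) ⅋ (A ᗮ)
(A ⅋ B) ᗮ = (B ᗮ) ⊗ (A ᗮ)
(A & B) ᗮ = (A ᗮ) ⊕ (B ᗮ)
(A ⊕ B) ᗮ = (A ᗮ) & (B ᗮ)
(! s · A) ᗮ = ¿ s · (A ᗮ)
(¿ s · A) ᗮ = ! s · (A ᗮ)

?ctx : ∀ {k} → List (Fin k × Fm k) → List (Fm k)
?ctx = map (λ p → ¿ proj₁ p · proj₂ p)

-- Derivability in SCLL_Σ (cut allowed iff withCut = true).
-- Cyclic sequents are lists, with rotation as the identification rule.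
module _ (Σ : Signature) where
  open Signature Σ

  data Der (withCut : Bool) : List (Fm n) → Set where
    ax   : ∀ A → Der withCut (A ∷ (A ᗮ) ∷ [])
    ⊗r   : ∀ {Γ Δ A B} → Der withCut (Γ ++ [ A ]) → Der withCut (B ∷ Δ)
         → Der withCut (Γ ++ (A ⊗ B) ∷ Δ)
    ⅋r   : ∀ {Γ A B} → Der withCut (A ∷ B ∷ Γ) → Der withCut ((A ⅋ B) ∷ Γ)
    &r   : ∀ {Γ A B} → Der withCut (A ∷ Γ) → Der withCut (B ∷ Γ)
         → Der withCut ((A & B) ∷ Γ)
    ⊕r₁  : ∀ {Γ A B} → Der withCut (A ∷ Γ) → Der withCut ((A ⊕ B) ∷ Γ)
    ⊕r₂  : ∀ {Γ A B} → Der withCut (B ∷ Γ) → Der withCut ((A ⊕ B) ∷ Γ)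
    𝟏r   : Der withCut [ 𝟏 ]
    ⊥r   : ∀ {Γ} → Der withCut Γ → Der withCut (⊥' ∷ Γ)
    ⊤r   : ∀ {Γ} → Der withCut (⊤' ∷ Γ)
    !r   : ∀ {s B} (ctx : List (Fin n × Fm n))
         → All (λ p → s ≼ proj₁ p) ctx
         → Der withCut (B ∷ ?ctx ctx) → Der withCut ((! s · B) ∷ ?ctx ctx)
    ?r   : ∀ {s A Γ} → Der withCut (A ∷ Γ) → Der withCut ((¿ s · A) ∷ Γ)
    weak : ∀ {s A Γ} → W s → Der withCut Γ → Der withCut ((¿ s · A) ∷ Γ)
    ncontr : ∀ {s A Γ Δ} → C s
         → Der withCut ((¿ s · A) ∷ Γ ++ (¿ s · A) ∷ Δ)
         → Der withCut ((¿ s · A) ∷ Γ ++ Δ)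
    ex   : ∀ {s A Γ Δ} → E s → Der withCut (Γ ++ (¿ s · A) ∷ Δ)
         → Der withCut ((¿ s · A) ∷ Γ ++ Δ)
    rot  : ∀ {Γ₁ Γ₂} → Der withCut (Γ₂ ++ Γ₁) → Der withCut (Γ₁ ++ Γ₂)
    cut  : ∀ {Γ Δ A} → T withCut → Γ ++ Δ ≢ []
         → Der withCut (Γ ++ [ A ᗮ ]) → Der withCut (A ∷ Δ)
         → Der withCut (Γ ++ Δ)

-- Okada-style phase semantics. Lists of formulas form a monoid, and cut-free derivability,
-- being invariant under rotation, is a pole for an orthogonality on sets of lists. Each formula
-- is interpreted as a fact ⟦ A ⟧ with ⟦ A ᗮ ⟧ = ⟦ A ⟧ ^⊥ and [ A ] ∈ ⟦ A ⟧. Every rule, cut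
-- included, preserves validity (all concatenations of realizers of a sequent are cut-free
-- derivable), so a derivable Γ, which realizes itself, is cut-free derivable. The structural
-- rules for subexponentials hold because ⟦ ¿ s · A ⟧ is generated by realizers that are
-- themselves ?-contexts above s, to which weakening, exchange and contraction apply.
module Submission where

open import Defs
open import Level using (0ℓ)
open import Data.Bool using (true; false)
open import Data.Fin using (Fin)
open import Data.List using (List; []; _∷_; _++_; [_]; map)
open import Data.List.Properties using (++-assoc; ++-identityʳ)
open import Data.List.Relation.Unary.All using (All; []; _∷_)
import Data.List.Relation.Unary.All as All
open import Data.List.Relation.Unary.All.Properties using (++⁺)
open import Data.Product using (_×_; _,_; proj₁; proj₂; ∃-syntax)
open import Function.Base using (_∘_; case_of_)
open import Function.Bundles using (_⇔_; mk⇔)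
open import Relation.Binary.PropositionalEquality using (_≡_; refl; sym; trans; cong; subst)
open import Relation.Unary using (Pred; _∈_; _⊆_; _≐_; _∩_; ∅; ｛_｝)
open import Relation.Unary.Properties using (≐-refl; ≐-sym; ≐-trans)

module _ {A : Set} where

  private variable
    X X′ Y Y′ : Pred (List A) 0ℓ

  infixr 7 _∙_

  data _∙_ (X Y : Pred (List A) 0ℓ) : Pred (List A) 0ℓ where
    _⁀_ : ∀ {x y} → x ∈ X → y ∈ Y → (X ∙ Y) (x ++ y)

  ∙-mono : X ⊆ X′ → Y ⊆ Y′ → X ∙ Y ⊆ X′ ∙ Y′
  ∙-mono f g (x ⁀ y) = f x ⁀ g y

  ∙-cong : X ≐ X′ → Y ≐ Y′ → X ∙ Y ≐ X′ ∙ Y′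
  ∙-cong (f , f′) (g , g′) = ∙-mono f g , ∙-mono f′ g′

  ∩-cong : X ≐ X′ → Y ≐ Y′ → X ∩ Y ≐ X′ ∩ Y′
  ∩-cong (f , f′) (g , g′) = (λ (x , y) → f x , g y) , (λ (x , y) → f′ x , g′ y)

  ⨂ : {I : Set} → (I → Pred (List A) 0ℓ) → List I → Pred (List A) 0ℓ
  ⨂ X []       = ｛ [] ｝
  ⨂ X (i ∷ is) = X i ∙ ⨂ X is

  module _ {I : Set} {X : I → Pred (List A) 0ℓ} where

    ⨂-++⁻ : ∀ is {js} → ⨂ X (is ++ js) ⊆ ⨂ X is ∙ ⨂ X js
    ⨂-++⁻ []       p = refl ⁀ p
    ⨂-++⁻ (i ∷ is) (_⁀_ {x} px p) with ⨂-++⁻ is p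
    ... | _⁀_ {y} {z} q r = subst (⨂ X (i ∷ is) ∙ _) (++-assoc x y z) ((px ⁀ q) ⁀ r)

    ⨂-++⁺ : ∀ is {js} → ⨂ X is ∙ ⨂ X js ⊆ ⨂ X (is ++ js)
    ⨂-++⁺ []       (refl ⁀ q) = q
    ⨂-++⁺ (i ∷ is) (_⁀_ {y = z} (_⁀_ {x} {y} px p) q) =
      subst (⨂ X (i ∷ _)) (sym (++-assoc x y z)) (px ⁀ ⨂-++⁺ is (p ⁀ q))

    ⨂-map : ∀ {J : Set} {f : J → I} js → ⨂ X (map f js) ≐ ⨂ (X ∘ f) js
    ⨂-map []       = ≐-refl
    ⨂-map (j ∷ js) = ∙-cong ≐-refl (⨂-map js)

  ⨂-mono : ∀ {I : Set} {X Y : I → Pred (List A) 0ℓ} {is} → (∀ {i} → X i ⊆ Y i) → ⨂ X is ⊆ ⨂ Y is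
  ⨂-mono {is = []}    f refl     = refl
  ⨂-mono {is = _ ∷ _} f (x ⁀ xs) = f x ⁀ ⨂-mono f xs

module Phase {A : Set} (P : Pred (List A) 0ℓ) (rotate : ∀ {x y} → P (x ++ y) → P (y ++ x)) where

  infix 10 _^⊥

  _^⊥ : Pred (List A) 0ℓ → Pred (List A) 0ℓ
  (X ^⊥) w = ∀ x → x ∈ X → P (x ++ w)

  Fact : Pred (List A) 0ℓ → Set
  Fact X = X ^⊥ ^⊥ ⊆ X

  private variable
    X Y : Pred (List A) 0ℓ

  ^⊥-applyʳ : ∀ {x y} → x ∈ X ^⊥ → y ∈ X → P (x ++ y)
  ^⊥-applyʳ {x = x} {y} ox py = rotate {y} {x} (ox y py)

  ^⊥-introʳ : ∀ {x} → (∀ y → y ∈ X → P (x ++ y)) → x ∈ X ^⊥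
  ^⊥-introʳ {x = x} h y py = rotate {x} {y} (h y py)

  ^⊥-antitone : X ⊆ Y → Y ^⊥ ⊆ X ^⊥
  ^⊥-antitone f oy x px = oy x (f px)

  ^⊥-cong : X ≐ Y → X ^⊥ ≐ Y ^⊥
  ^⊥-cong (f , g) = ^⊥-antitone g , ^⊥-antitone f

  ^⊥^⊥-extensive : X ⊆ X ^⊥ ^⊥
  ^⊥^⊥-extensive px u ou = ^⊥-applyʳ ou px

  ^⊥-fact : Fact (X ^⊥)
  ^⊥-fact = ^⊥-antitone ^⊥^⊥-extensive

  fact-≐ : Fact X → X ^⊥ ^⊥ ≐ X
  fact-≐ fact = fact , ^⊥^⊥-extensive

  ^⊥^⊥^⊥ : X ^⊥ ^⊥ ^⊥ ≐ X ^⊥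
  ^⊥^⊥^⊥ = fact-≐ ^⊥-fact

  ∩-fact : Fact X → Fact Y → Fact (X ∩ Y)
  ∩-fact fX fY p = fX (^⊥-antitone (^⊥-antitone proj₁) p) , fY (^⊥-antitone (^⊥-antitone proj₂) p)

  ^⊥-flip : Fact X → Y ≐ X ^⊥ → Y ^⊥ ≐ X
  ^⊥-flip fX (f , g) = fX ∘ ^⊥-antitone g , ^⊥-antitone f ∘ ^⊥^⊥-extensive

  ∙-^⊥^⊥ : X ^⊥ ^⊥ ∙ Y ^⊥ ^⊥ ⊆ (X ∙ Y) ^⊥ ^⊥
  ∙-^⊥^⊥ {X} {Y} (_⁀_ {x} {y} px py) z oz = subst P (++-assoc z x y) (py (z ++ x) zx⊥Y)
    where
      zx⊥Y : z ++ x ∈ Y ^⊥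
      zx⊥Y y′ qy = subst P (++-assoc y′ z x) (px (y′ ++ z) y′z⊥X)
        where
          y′z⊥X : y′ ++ z ∈ X ^⊥
          y′z⊥X x′ qx = subst P (++-assoc x′ y′ z) (oz (x′ ++ y′) (qx ⁀ qy))

  ⨂-^⊥^⊥ : ∀ {I : Set} {X : I → Pred (List A) 0ℓ} is → ⨂ (λ i → X i ^⊥ ^⊥) is ⊆ (⨂ X is) ^⊥ ^⊥
  ⨂-^⊥^⊥ []       p        = ^⊥^⊥-extensive p
  ⨂-^⊥^⊥ (i ∷ is) (px ⁀ p) = ∙-^⊥^⊥ (px ⁀ ⨂-^⊥^⊥ is p)

module CutElimination (Σ : Signature) where
  open Signature Σ

  infix 3 ⊢_

  ⊢_ : Pred (List (Fm n)) 0ℓ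
  ⊢_ = Der Σ false

  rotate : ∀ {x y} → ⊢ x ++ y → ⊢ y ++ x
  rotate {x} {y} = rot {Γ₁ = y} {Γ₂ = x}

  rotate₃ : ∀ x y z → ⊢ x ++ y ++ z → ⊢ (z ++ x) ++ y
  rotate₃ x y z d =
    subst ⊢_ (sym (++-assoc z x y)) (rotate {x ++ y} {z} (subst ⊢_ (sym (++-assoc x y z)) d))

  rotate₃⁻¹ : ∀ x y z → ⊢ (z ++ x) ++ y → ⊢ x ++ y ++ z
  rotate₃⁻¹ x y z d =
    subst ⊢_ (++-assoc x y z) (rotate {z} {x ++ y} (subst ⊢_ (++-assoc z x y) d))

  open Phase ⊢_ (λ {x} {y} → rotate {x} {y})

  data ¿Above (s : Fin n) : Fm n → Set where
    ¿above : ∀ {t A} → s ≼ t → ¿Above s (¿ t · A)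

  Promotable : Fin n → Pred (List (Fm n)) 0ℓ
  Promotable s = All (¿Above s)

  Promotable-≼ : ∀ {s t} → s ≼ t → Promotable t ⊆ Promotable s
  Promotable-≼ s≼t = All.map λ { (¿above t≼u) → ¿above (≼-trans s≼t t≼u) }

  promotable-?ctx : ∀ {s Γ} → Promotable s Γ → ∃[ ctx ] (?ctx ctx ≡ Γ × All (λ p → s ≼ proj₁ p) ctx)
  promotable-?ctx []                        = [] , refl , []
  promotable-?ctx (¿above {t} {A} s≼t ∷ pΓ) with promotable-?ctx pΓ
  ... | ctx , refl , all = (t , A) ∷ ctx , refl , s≼t ∷ all

  !r-promotable : ∀ {s B Γ} → Promotable s Γ → ⊢ B ∷ Γ → ⊢ ! s · B ∷ Γ
  !r-promotable pΓ d with promotable-?ctx pΓ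
  ... | ctx , refl , all = !r ctx all d

  weaken-promotable : ∀ {s x Γ} → W s → Promotable s x → ⊢ Γ → ⊢ x ++ Γ
  weaken-promotable ws []                 d = d
  weaken-promotable ws (¿above s≼t ∷ px) d = weak (W-up ws s≼t) (weaken-promotable ws px d)

  exchange-promotable : ∀ {s x} Γ Δ → E s → Promotable s x → ⊢ Γ ++ x ++ Δ → ⊢ x ++ Γ ++ Δ
  exchange-promotable Γ Δ es [] d = d
  exchange-promotable {x = q ∷ x} Γ Δ es (¿above s≼t ∷ px) d =
    subst ⊢_ (cong (q ∷_) (++-assoc x Γ Δ)) (ex {Γ = x ++ Γ} (E-up es s≼t) (subst ⊢_ q-moved IH))
    where
      IH : ⊢ x ++ (Γ ++ [ q ]) ++ Δ
      IH = exchange-promotable (Γ ++ [ q ]) Δ es px (subst ⊢_ (sym (++-assoc Γ [ q ] (x ++ Δ))) d)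
      q-moved : x ++ (Γ ++ [ q ]) ++ Δ ≡ (x ++ Γ) ++ q ∷ Δ
      q-moved = trans (cong (x ++_) (++-assoc Γ [ q ] Δ)) (sym (++-assoc x Γ (q ∷ Δ)))

  contract-promotable : ∀ {s x} Γ Δ → C s → Promotable s x → ⊢ x ++ Γ ++ x ++ Δ → ⊢ x ++ Γ ++ Δ
  contract-promotable Γ Δ cs [] d = d
  contract-promotable {x = q ∷ x} Γ Δ cs (¿above s≼t ∷ px) d =
    rotate {x ++ Γ ++ Δ} {[ q ]} (subst ⊢_ q-last IH)
    where
      contracted : ⊢ q ∷ (x ++ Γ) ++ x ++ Δ
      contracted = ncontr (C-up cs s≼t) (subst ⊢_ (cong (q ∷_) (sym (++-assoc x Γ (q ∷ x ++ Δ)))) d)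
      q-moved : ((x ++ Γ) ++ x ++ Δ) ++ [ q ] ≡ x ++ Γ ++ x ++ Δ ++ [ q ]
      q-moved = trans (++-assoc (x ++ Γ) (x ++ Δ) [ q ])
                  (trans (++-assoc x Γ _) (cong (λ z → x ++ Γ ++ z) (++-assoc x Δ [ q ])))
      IH : ⊢ x ++ Γ ++ Δ ++ [ q ]
      IH = contract-promotable Γ (Δ ++ [ q ]) cs px (subst ⊢_ q-moved (rotate {[ q ]} contracted))
      q-last : x ++ Γ ++ Δ ++ [ q ] ≡ (x ++ Γ ++ Δ) ++ [ q ]
      q-last = sym (trans (++-assoc x (Γ ++ Δ) [ q ]) (cong (x ++_) (++-assoc Γ Δ [ q ])))

  -- ⟦ A ⟧ collects the lists that may replace A in a cut-free derivable sequent
  -- (hence ⟦ A ⊕ B ⟧ is an intersection).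
  ⟦_⟧ : Fm n → Pred (List (Fm n)) 0ℓ
  ⟦ var i ⟧   = ｛ [ nvar i ] ｝ ^⊥
  ⟦ nvar i ⟧  = ｛ [ nvar i ] ｝ ^⊥ ^⊥
  ⟦ 𝟏 ⟧       = ｛ [] ｝ ^⊥
  ⟦ ⊥' ⟧      = ｛ [] ｝ ^⊥ ^⊥
  ⟦ ⊤' ⟧      = ∅ ^⊥ ^⊥
  ⟦ 𝟎 ⟧       = ∅ ^⊥
  ⟦ A ⊗ B ⟧   = (⟦ B ⟧ ^⊥ ∙ ⟦ A ⟧ ^⊥) ^⊥
  ⟦ A ⅋ B ⟧   = (⟦ A ⟧ ∙ ⟦ B ⟧) ^⊥ ^⊥
  ⟦ A & B ⟧   = (⟦ A ⟧ ^⊥ ∩ ⟦ B ⟧ ^⊥) ^⊥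
  ⟦ A ⊕ B ⟧   = ⟦ A ⟧ ∩ ⟦ B ⟧
  ⟦ ! s · A ⟧ = (⟦ A ⟧ ^⊥ ∩ Promotable s) ^⊥
  ⟦ ¿ s · A ⟧ = (⟦ A ⟧ ∩ Promotable s) ^⊥ ^⊥

  ⟦⟧-fact : ∀ A → Fact ⟦ A ⟧
  ⟦⟧-fact (var i)   = ^⊥-fact
  ⟦⟧-fact (nvar i)  = ^⊥-fact
  ⟦⟧-fact 𝟏         = ^⊥-fact
  ⟦⟧-fact ⊥'        = ^⊥-fact
  ⟦⟧-fact ⊤'        = ^⊥-fact
  ⟦⟧-fact 𝟎         = ^⊥-fact
  ⟦⟧-fact (A ⊗ B)   = ^⊥-fact
  ⟦⟧-fact (A ⅋ B)   = ^⊥-fact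
  ⟦⟧-fact (A & B)   = ^⊥-fact
  ⟦⟧-fact (A ⊕ B)   = ∩-fact (⟦⟧-fact A) (⟦⟧-fact B)
  ⟦⟧-fact (! s · A) = ^⊥-fact
  ⟦⟧-fact (¿ s · A) = ^⊥-fact

  ⟦ᗮ⟧   : ∀ A → ⟦ A ᗮ ⟧ ≐ ⟦ A ⟧ ^⊥
  ⟦ᗮ⟧ᗮ : ∀ A → ⟦ A ᗮ ⟧ ^⊥ ≐ ⟦ A ⟧

  ⟦ᗮ⟧ (var i)   = ≐-refl
  ⟦ᗮ⟧ (nvar i)  = ≐-sym ^⊥^⊥^⊥
  ⟦ᗮ⟧ 𝟏         = ≐-refl
  ⟦ᗮ⟧ ⊥'        = ≐-sym ^⊥^⊥^⊥
  ⟦ᗮ⟧ ⊤'        = ≐-sym ^⊥^⊥^⊥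
  ⟦ᗮ⟧ 𝟎         = ≐-refl
  ⟦ᗮ⟧ (A ⊗ B)   = ^⊥-cong (^⊥-cong (∙-cong (⟦ᗮ⟧ B) (⟦ᗮ⟧ A)))
  ⟦ᗮ⟧ (A ⅋ B)   = ≐-trans (^⊥-cong (∙-cong (⟦ᗮ⟧ᗮ A) (⟦ᗮ⟧ᗮ B))) (≐-sym ^⊥^⊥^⊥)
  ⟦ᗮ⟧ (A & B)   = ≐-trans (∩-cong (⟦ᗮ⟧ A) (⟦ᗮ⟧ B)) (≐-sym (fact-≐ (∩-fact ^⊥-fact ^⊥-fact)))
  ⟦ᗮ⟧ (A ⊕ B)   = ^⊥-cong (∩-cong (⟦ᗮ⟧ᗮ A) (⟦ᗮ⟧ᗮ B))
  ⟦ᗮ⟧ (! s · A) = ^⊥-cong (^⊥-cong (∩-cong (⟦ᗮ⟧ A) ≐-refl))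
  ⟦ᗮ⟧ (¿ s · A) = ≐-trans (^⊥-cong (∩-cong (⟦ᗮ⟧ᗮ A) ≐-refl)) (≐-sym ^⊥^⊥^⊥)

  ⟦ᗮ⟧ᗮ A = ^⊥-flip (⟦⟧-fact A) (⟦ᗮ⟧ A)

  ⟦⟧-intro : ∀ A {B} → (∀ u → u ∈ ⟦ A ⟧ ^⊥ → ⊢ B ∷ u) → [ B ] ∈ ⟦ A ⟧
  ⟦⟧-intro A h = ⟦⟧-fact A (^⊥-introʳ h)

  [A]∈⟦A⟧ : ∀ A → [ A ] ∈ ⟦ A ⟧
  [A]∈⟦A⟧ (var i)   _ refl = ax (nvar i)
  [A]∈⟦A⟧ (nvar i)  = ^⊥^⊥-extensive refl
  [A]∈⟦A⟧ 𝟏         _ refl = 𝟏r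
  [A]∈⟦A⟧ ⊥'        = ^⊥-introʳ λ u ou → ⊥r (ou [] refl)
  [A]∈⟦A⟧ ⊤'        = ^⊥-introʳ λ _ _ → ⊤r
  [A]∈⟦A⟧ 𝟎         _ ()
  [A]∈⟦A⟧ (A ⊗ B)   _ (_⁀_ {d} {g} od og) =
    rotate₃ g [ A ⊗ B ] d (⊗r (rotate {[ A ]} {g} (og [ A ] ([A]∈⟦A⟧ A))) (od [ B ] ([A]∈⟦A⟧ B)))
  [A]∈⟦A⟧ (A ⅋ B)   = ^⊥-introʳ λ u ou → ⅋r (ou (A ∷ B ∷ []) ([A]∈⟦A⟧ A ⁀ [A]∈⟦A⟧ B))
  [A]∈⟦A⟧ (A & B)   = ^⊥-introʳ λ u (oA , oB) → &r (oA [ A ] ([A]∈⟦A⟧ A)) (oB [ B ] ([A]∈⟦A⟧ B))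
  [A]∈⟦A⟧ (A ⊕ B)   = ⟦⟧-intro A (λ u oA → ⊕r₁ (oA [ A ] ([A]∈⟦A⟧ A)))
                    , ⟦⟧-intro B (λ u oB → ⊕r₂ (oB [ B ] ([A]∈⟦A⟧ B)))
  [A]∈⟦A⟧ (! s · A) u (oA , pu) = rotate {[ ! s · A ]} {u} (!r-promotable pu (oA [ A ] ([A]∈⟦A⟧ A)))
  [A]∈⟦A⟧ (¿ s · A) =
    ^⊥^⊥-extensive (⟦⟧-intro A (λ u oA → ?r (oA [ A ] ([A]∈⟦A⟧ A))) , ¿above ≼-refl ∷ [])

  ⟦_⟧* : List (Fm n) → Pred (List (Fm n)) 0ℓ
  ⟦_⟧* = ⨂ ⟦_⟧

  Γ∈⟦Γ⟧* : ∀ Γ → Γ ∈ ⟦ Γ ⟧*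
  Γ∈⟦Γ⟧* []      = refl
  Γ∈⟦Γ⟧* (A ∷ Γ) = [A]∈⟦A⟧ A ⁀ Γ∈⟦Γ⟧* Γ

  record Valid (Γ : List (Fm n)) : Set where
    constructor valid
    field realizers-derivable : ⟦ Γ ⟧* ⊆ ⊢_

  valid-∷ : ∀ {A Δ} → Valid (A ∷ Δ) → ⟦ Δ ⟧* ⊆ ⟦ A ⟧ ^⊥
  valid-∷ (valid v) rΔ a ra = v (ra ⁀ rΔ)

  valid-∷ʳ : ∀ Γ {A} → Valid (Γ ++ [ A ]) → ⟦ Γ ⟧* ⊆ ⟦ A ⟧ ^⊥
  valid-∷ʳ Γ (valid v) {g} rΓ a ra =
    rotate {g} {a} (subst (λ z → ⊢ g ++ z) (++-identityʳ a) (v (⨂-++⁺ Γ (rΓ ⁀ (ra ⁀ refl)))))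

  valid-ax : ∀ A → Valid (A ∷ A ᗮ ∷ [])
  valid-ax A = valid λ { (_⁀_ {x} rx (_⁀_ {y} ry refl)) →
    subst ⊢_ (cong (x ++_) (sym (++-identityʳ y))) (proj₁ (⟦ᗮ⟧ A) ry x rx) }

  valid-⊗r : ∀ {Γ Δ A B} → Valid (Γ ++ [ A ]) → Valid (B ∷ Δ) → Valid (Γ ++ A ⊗ B ∷ Δ)
  valid-⊗r {Γ} v₁ v₂ = valid λ r → case ⨂-++⁻ Γ r of λ where
    (_⁀_ {g} rΓ (_⁀_ {t} {d} rt rΔ)) → rotate₃⁻¹ g t d (rt (d ++ g) (valid-∷ v₂ rΔ ⁀ valid-∷ʳ Γ v₁ rΓ))

  valid-⅋r : ∀ {Γ A B} → Valid (A ∷ B ∷ Γ) → Valid (A ⅋ B ∷ Γ)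
  valid-⅋r (valid v) = valid λ { (_⁀_ {y = g} rt rΓ) → ^⊥-applyʳ rt λ where
    _ (_⁀_ {a} {b} ra rb) → subst ⊢_ (sym (++-assoc a b g)) (v (ra ⁀ (rb ⁀ rΓ))) }

  valid-&r : ∀ {Γ A B} → Valid (A ∷ Γ) → Valid (B ∷ Γ) → Valid (A & B ∷ Γ)
  valid-&r v₁ v₂ = valid λ { (rt ⁀ rΓ) → ^⊥-applyʳ rt (valid-∷ v₁ rΓ , valid-∷ v₂ rΓ) }

  valid-⊕r₁ : ∀ {Γ A B} → Valid (A ∷ Γ) → Valid (A ⊕ B ∷ Γ)
  valid-⊕r₁ (valid v) = valid λ { ((rA , _) ⁀ rΓ) → v (rA ⁀ rΓ) }

  valid-⊕r₂ : ∀ {Γ A B} → Valid (B ∷ Γ) → Valid (A ⊕ B ∷ Γ)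
  valid-⊕r₂ (valid v) = valid λ { ((_ , rB) ⁀ rΓ) → v (rB ⁀ rΓ) }

  valid-𝟏r : Valid [ 𝟏 ]
  valid-𝟏r = valid λ { (_⁀_ {t} rt refl) → subst ⊢_ (sym (++-identityʳ t)) (rt [] refl) }

  valid-⊥r : ∀ {Γ} → Valid Γ → Valid (⊥' ∷ Γ)
  valid-⊥r (valid v) = valid λ { (rt ⁀ rΓ) → ^⊥-applyʳ rt λ { _ refl → v rΓ } }

  valid-⊤r : ∀ {Γ} → Valid (⊤' ∷ Γ)
  valid-⊤r = valid λ { (rt ⁀ _) → ^⊥-applyʳ rt λ _ () }

  valid-?r : ∀ {s A Γ} → Valid (A ∷ Γ) → Valid (¿ s · A ∷ Γ)
  valid-?r (valid v) = valid λ { (rt ⁀ rΓ) → ^⊥-applyʳ rt λ _ (ra , _) → v (ra ⁀ rΓ) }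

  valid-weak : ∀ {s A Γ} → W s → Valid Γ → Valid (¿ s · A ∷ Γ)
  valid-weak ws (valid v) =
    valid λ { (rt ⁀ rΓ) → ^⊥-applyʳ rt λ _ (_ , px) → weaken-promotable ws px (v rΓ) }

  valid-ex : ∀ {s A Γ Δ} → E s → Valid (Γ ++ ¿ s · A ∷ Δ) → Valid (¿ s · A ∷ Γ ++ Δ)
  valid-ex {Γ = Γ} es (valid v) = valid λ { (rt ⁀ rΓΔ) → case ⨂-++⁻ Γ rΓΔ of λ where
    (_⁀_ {g} {d} rΓ rΔ) → ^⊥-applyʳ rt λ _ q@(_ , px) →
      exchange-promotable g d es px (v (⨂-++⁺ Γ (rΓ ⁀ (^⊥^⊥-extensive q ⁀ rΔ)))) }

  valid-ncontr : ∀ {s A Γ Δ} → C s → Valid (¿ s · A ∷ Γ ++ ¿ s · A ∷ Δ) → Valid (¿ s · A ∷ Γ ++ Δ)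
  valid-ncontr {Γ = Γ} cs (valid v) = valid λ { (rt ⁀ rΓΔ) → case ⨂-++⁻ Γ rΓΔ of λ where
    (_⁀_ {g} {d} rΓ rΔ) → ^⊥-applyʳ rt λ _ q@(_ , px) →
      let rq = ^⊥^⊥-extensive q in
      contract-promotable g d cs px (v (rq ⁀ ⨂-++⁺ Γ (rΓ ⁀ (rq ⁀ rΔ)))) }

  valid-rot : ∀ {Γ₁ Γ₂} → Valid (Γ₂ ++ Γ₁) → Valid (Γ₁ ++ Γ₂)
  valid-rot {Γ₁} {Γ₂} (valid v) = valid λ r → case ⨂-++⁻ Γ₁ r of λ where
    (_⁀_ {x} {y} r₁ r₂) → rotate {y} {x} (v (⨂-++⁺ Γ₂ (r₂ ⁀ r₁)))

  valid-cut : ∀ {Γ Δ A} → Valid (Γ ++ [ A ᗮ ]) → Valid (A ∷ Δ) → Valid (Γ ++ Δ)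
  valid-cut {Γ} {A = A} v₁ (valid v₂) = valid λ r → case ⨂-++⁻ Γ r of λ where
    (rΓ ⁀ rΔ) → v₂ (proj₁ (⟦ᗮ⟧ᗮ A) (valid-∷ʳ Γ v₁ rΓ) ⁀ rΔ)

  ¿-base : Fin n × Fm n → Pred (List (Fm n)) 0ℓ
  ¿-base p = ⟦ proj₂ p ⟧ ∩ Promotable (proj₁ p)

  ¿-base-promotable : ∀ {s ctx} → All (λ p → s ≼ proj₁ p) ctx → ⨂ ¿-base ctx ⊆ Promotable s
  ¿-base-promotable []            refl            = []
  ¿-base-promotable (s≼t ∷ ctx≽s) ((_ , px) ⁀ r) =
    ++⁺ (Promotable-≼ s≼t px) (¿-base-promotable ctx≽s r)

  valid-!r : ∀ {s B} ctx → All (λ p → s ≼ proj₁ p) ctx → Valid (B ∷ ?ctx ctx) → Valid (! s · B ∷ ?ctx ctx)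
  -- The realizer of the ?-context lies in the biorthogonal of the product of the ¿-bases,
  -- and the premise makes the realizer of ! s · B orthogonal to that product.
  valid-!r ctx ctx≽s v = valid λ { (_⁀_ {t} rt rctx) → ⨂-^⊥^⊥ ctx (proj₁ (⨂-map ctx) rctx) t λ x rx →
    rt x (valid-∷ v (proj₂ (⨂-map ctx) (⨂-mono ^⊥^⊥-extensive rx)) , ¿-base-promotable ctx≽s rx) }

  sound : ∀ {b Γ} → Der Σ b Γ → Valid Γ
  sound (ax A)            = valid-ax A
  sound (⊗r d e)          = valid-⊗r (sound d) (sound e)
  sound (⅋r d)            = valid-⅋r (sound d)
  sound (&r d e)          = valid-&r (sound d) (sound e)
  sound (⊕r₁ d)           = valid-⊕r₁ (sound d)
  sound (⊕r₂ d)           = valid-⊕r₂ (sound d)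
  sound 𝟏r                = valid-𝟏r
  sound (⊥r d)            = valid-⊥r (sound d)
  sound ⊤r                = valid-⊤r
  sound (!r ctx ctx≽s d)  = valid-!r ctx ctx≽s (sound d)
  sound (?r d)            = valid-?r (sound d)
  sound (weak ws d)       = valid-weak ws (sound d)
  sound (ncontr cs d)     = valid-ncontr cs (sound d)
  sound (ex es d)         = valid-ex es (sound d)
  sound (rot {Γ₁} {Γ₂} d) = valid-rot {Γ₁} {Γ₂} (sound d)
  sound (cut _ _ d e)     = valid-cut (sound d) (sound e)

  cut-elimination : ∀ {b Γ} → Der Σ b Γ → ⊢ Γ
  cut-elimination {Γ = Γ} d = Valid.realizers-derivable (sound d) (Γ∈⟦Γ⟧* Γ)

  cut-free⇒Der : ∀ {b Γ} → ⊢ Γ → Der Σ b Γ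
  cut-free⇒Der (ax A)             = ax A
  cut-free⇒Der (⊗r d e)           = ⊗r (cut-free⇒Der d) (cut-free⇒Der e)
  cut-free⇒Der (⅋r d)             = ⅋r (cut-free⇒Der d)
  cut-free⇒Der (&r d e)           = &r (cut-free⇒Der d) (cut-free⇒Der e)
  cut-free⇒Der (⊕r₁ d)            = ⊕r₁ (cut-free⇒Der d)
  cut-free⇒Der (⊕r₂ d)            = ⊕r₂ (cut-free⇒Der d)
  cut-free⇒Der 𝟏r                 = 𝟏r
  cut-free⇒Der (⊥r d)             = ⊥r (cut-free⇒Der d)
  cut-free⇒Der ⊤r                 = ⊤r
  cut-free⇒Der (!r ctx ctx≽s d)   = !r ctx ctx≽s (cut-free⇒Der d)
  cut-free⇒Der (?r d)             = ?r (cut-free⇒Der d)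
  cut-free⇒Der (weak ws d)        = weak ws (cut-free⇒Der d)
  cut-free⇒Der (ncontr cs d)      = ncontr cs (cut-free⇒Der d)
  cut-free⇒Der (ex es d)          = ex es (cut-free⇒Der d)
  cut-free⇒Der (rot {Γ₁} {Γ₂} d)  = rot {Γ₁ = Γ₁} {Γ₂ = Γ₂} (cut-free⇒Der d)
  cut-free⇒Der (cut () _ _ _)

theorem1 : (Σ : Signature) (Γ : List (Fm (Signature.n Σ)))
           → Der Σ true Γ ⇔ Der Σ false Γ
theorem1 Σ Γ = mk⇔ cut-elimination cut-free⇒Der
  where open CutElimination Σ
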